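{- Let $\mathbb N_\bot$ be the poset with carrier $\mathbb N+\mathbf 1$ and order given by $x\sqsubseteq y$ iff $x=\mathrm{inr}(\star)$ or $x=y$. If $\mathbb N_\bot$ is $\omega$-complete (every sequence $x_0\sqsubseteq x_1\sqsubseteq x_2\sqsubseteq\cdots$ has a least upper bound), then LPO holds: for every $\alpha:\mathbb N\to\mathbf 2$ the proposition $\exists_{n:\mathbb N}\,\alpha(n)=1$ is decidable. In particular, if $\mathbb N_\bot$ is $\mathcal U_0$-directed complete, then LPO holds.
   Context: Setting: intensional Martin-Löf type theory with universes $\mathcal U_0,\mathcal U_1,\dots$, function extensionality, propositional extensionality and propositional truncations ($\exists$ is the truncated $\Sigma$); no excluded middle. A proposition $P$ is decidable if $P+\neg P$. A family $\alpha:I\to D$ in a poset is directed if $I$ is inhabited ($\|I\|$) and for all $i,j:I$ there exists $k$ with $\alpha_i,\alpha_j\sqsubseteq\alpha_k$; a poset is $\mathcal U_0$-directed complete if every directed family indexed by a type in $\mathcal U_0$ has a least upper bound. -}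

module Defs where

open import Level using (Level; _⊔_) renaming (suc to lsuc; zero to lzero)

open import Data.Nat using (ℕ; suc)
open import Data.Bool using (Bool; true)
open import Data.Sum using (_⊎_; inj₁; inj₂)
open import Data.Unit using (⊤; tt)
open import Data.Product using (Σ; _×_; Σ-syntax)
open import Relation.Binary.PropositionalEquality using (_≡_)
open import Relation.Nullary using (¬_)

isProp : Set → Set
isProp P = (x y : P) → x ≡ y

-- Propositional truncation, impredicative encoding (eliminates into all
-- propositions of the base universe 𝓤₀ = Set).
∥_∥ : {ℓ : Level} → Set ℓ → Set (lsuc lzero ⊔ ℓ)
∥ A ∥ = (P : Set) → isProp P → (A → P) → P

∃∥ : {ℓ : Level} (A : Set) → (A → Set ℓ) → Set (lsuc lzero ⊔ ℓ)
∃∥ A B = ∥ Σ A B ∥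

IsDecidable : Set₁ → Set₁
IsDecidable P = P ⊎ ¬ P

ℕ⊥ : Set
ℕ⊥ = ℕ ⊎ ⊤

bot : ℕ⊥
bot = inj₂ tt

_⊑_ : ℕ⊥ → ℕ⊥ → Set₁
x ⊑ y = ∥ (x ≡ bot) ⊎ (x ≡ y) ∥

IsUpperBound : {I : Set} → (I → ℕ⊥) → ℕ⊥ → Set₁
IsUpperBound {I} α s = (i : I) → α i ⊑ s

IsLub : {I : Set} → (I → ℕ⊥) → ℕ⊥ → Set₁
IsLub α s = IsUpperBound α s × ((t : ℕ⊥) → IsUpperBound α t → s ⊑ t)

OmegaComplete : Set₁
OmegaComplete = (x : ℕ → ℕ⊥) → ((n : ℕ) → x n ⊑ x (suc n)) → Σ ℕ⊥ (IsLub x)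

IsDirected : {I : Set} → (I → ℕ⊥) → Set₁
IsDirected {I} α =
  ∥ I ∥ × ((i j : I) → ∃∥ I (λ k → (α i ⊑ α k) × (α j ⊑ α k)))

DirectedComplete : Set₁
DirectedComplete = (I : Set) (α : I → ℕ⊥) → IsDirected α → Σ ℕ⊥ (IsLub α)

LPO : Set₁
LPO = (α : ℕ → Bool) → IsDecidable (∃∥ ℕ (λ n → α n ≡ true))

-- Given α : ℕ → 𝟐, the sequence whose n-th term is the least k < n with
-- α k = 1 (or ⊥ if there is none) is increasing in ℕ⊥.  Its supremum is
-- either ⊥, in which case α is constantly 0, or some m, in which case
-- α m = 1: otherwise every term would be ⊥, and so would the supremum.
-- An increasing sequence is a directed family, so 𝓤₀-directed completeness
-- implies ω-completeness.
module Submission where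

open import Defs
open import Level using (Level)
open import Data.Bool using (Bool; true; false)
open import Data.Empty using (⊥; ⊥-elim)
open import Data.Nat using (ℕ; zero; suc; _+_)
open import Data.Nat.Properties using (+-comm; ≡-irrelevant)
open import Data.Product using (Σ; _×_; _,_)
open import Data.Sum using (inj₁; inj₂)
open import Data.Sum.Properties using (inj₁-injective)
open import Data.Unit using (tt)
open import Relation.Binary.PropositionalEquality using (_≡_; refl; sym; trans; subst)
open import Relation.Nullary using (¬_)

∣_∣ : {ℓ : Level} {A : Set ℓ} → A → ∥ A ∥
∣ a ∣ _ _ f = f a

∥-rec : {ℓ : Level} {A : Set ℓ} {P : Set} → isProp P → (A → P) → ∥ A ∥ → P
∥-rec isPropP f t = t _ isPropP f

isProp⊥ : isProp ⊥
isProp⊥ ()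

⊑-refl : {x : ℕ⊥} → x ⊑ x
⊑-refl = ∣ inj₂ refl ∣

⊑-trans : {x y z : ℕ⊥} → x ⊑ y → y ⊑ z → x ⊑ z
⊑-trans x⊑y y⊑z P isPropP f = x⊑y P isPropP λ where
  (inj₁ x≡bot) → f (inj₁ x≡bot)
  (inj₂ refl)  → y⊑z P isPropP f

inj₁⋢bot : {k : ℕ} → ¬ (inj₁ k ⊑ bot)
inj₁⋢bot = ∥-rec isProp⊥ λ where
  (inj₁ ())
  (inj₂ ())

inj₁-⊑-inj₁ : {k m : ℕ} → inj₁ k ⊑ inj₁ m → k ≡ m
inj₁-⊑-inj₁ = ∥-rec (λ p q → ≡-irrelevant p q) λ where
  (inj₁ ())
  (inj₂ k≡m) → inj₁-injective k≡m

Increasing : (ℕ → ℕ⊥) → Set₁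
Increasing x = (n : ℕ) → x n ⊑ x (suc n)

increasing-⊑-+ : {x : ℕ → ℕ⊥} → Increasing x → (i d : ℕ) → x i ⊑ x (d + i)
increasing-⊑-+ inc i zero    = ⊑-refl
increasing-⊑-+ inc i (suc d) = ⊑-trans (increasing-⊑-+ inc i d) (inc (d + i))

increasing⇒directed : {x : ℕ → ℕ⊥} → Increasing x → IsDirected x
increasing⇒directed {x} inc = ∣ zero ∣ , λ i j →
  ∣ j + i , increasing-⊑-+ inc i j
          , subst (λ k → x j ⊑ x k) (+-comm i j) (increasing-⊑-+ inc j i) ∣

directedComplete⇒omegaComplete : DirectedComplete → OmegaComplete
directedComplete⇒omegaComplete dc x inc = dc ℕ x (increasing⇒directed inc)

extend : ℕ⊥ → Bool → ℕ → ℕ⊥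
extend (inj₁ k)  _     _ = inj₁ k
extend (inj₂ tt) true  n = inj₁ n
extend (inj₂ tt) false _ = bot

⊑-extend : (a : ℕ⊥) (b : Bool) (n : ℕ) → a ⊑ extend a b n
⊑-extend (inj₁ k)  _ _ = ⊑-refl
⊑-extend (inj₂ tt) _ _ = ∣ inj₁ refl ∣

searchBelow : (ℕ → Bool) → ℕ → ℕ⊥
searchBelow α zero    = bot
searchBelow α (suc n) = extend (searchBelow α n) (α n) n

searchBelow-increasing : (α : ℕ → Bool) → Increasing (searchBelow α)
searchBelow-increasing α n = ⊑-extend (searchBelow α n) (α n) n

searchBelow-sound : (α : ℕ → Bool) (n : ℕ) {k : ℕ} →
                    searchBelow α n ≡ inj₁ k → α k ≡ true
searchBelow-sound α (suc n) found with searchBelow α n in earlier | α n in αn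
... | inj₁ j  | _     = searchBelow-sound α n (trans earlier found)
... | inj₂ tt | true  = subst (λ j → α j ≡ true) (inj₁-injective found) αn
searchBelow-sound α (suc n) () | inj₂ tt | false

searchBelow-complete : (α : ℕ → Bool) (n : ℕ) → α n ≡ true →
                       Σ ℕ (λ k → searchBelow α (suc n) ≡ inj₁ k)
searchBelow-complete α n αn rewrite αn with searchBelow α n
... | inj₁ k  = k , refl
... | inj₂ tt = n , refl

searchBelow-bounded-sound : (α : ℕ → Bool) (n : ℕ) {k m : ℕ} →
                            searchBelow α n ⊑ inj₁ m → searchBelow α n ≡ inj₁ k →
                            α m ≡ true
searchBelow-bounded-sound α n {m = m} bounded found =
  subst (λ j → α j ≡ true) (inj₁-⊑-inj₁ (subst (_⊑ inj₁ m) found bounded))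
        (searchBelow-sound α n found)

lub-decides-∃ : (α : ℕ → Bool) → Σ ℕ⊥ (IsLub (searchBelow α)) →
                IsDecidable (∃∥ ℕ (λ n → α n ≡ true))
lub-decides-∃ α (inj₂ tt , upper , _) = inj₂ (∥-rec isProp⊥ λ where
  (n , αn) → let (k , found) = searchBelow-complete α n αn
             in inj₁⋢bot (subst (_⊑ bot) found (upper (suc n))))
lub-decides-∃ α (inj₁ m , upper , least) = inj₁ ∣ m , αm ∣
  where
  bot-upper : α m ≡ false → IsUpperBound (searchBelow α) bot
  bot-upper αm≡false n with searchBelow α n in found
  ... | inj₂ tt = ⊑-refl
  ... | inj₁ k
    with () ← trans (sym αm≡false) (searchBelow-bounded-sound α n (upper n) found)

  αm : α m ≡ true
  αm with α m in αm≡
  ... | true  = refl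
  ... | false = ⊥-elim (inj₁⋢bot (least bot (bot-upper αm≡)))

omegaComplete⇒LPO : OmegaComplete → LPO
omegaComplete⇒LPO oc α = lub-decides-∃ α (oc (searchBelow α) (searchBelow-increasing α))

mainTheorem11 : (OmegaComplete → LPO) × (DirectedComplete → LPO)
mainTheorem11 = omegaComplete⇒LPO
              , λ dc → omegaComplete⇒LPO (directedComplete⇒omegaComplete dc)
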